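{- Let $G = (V, E)$ be a finite simple undirected graph and let $E' \subseteq E$ be a subset of its edges with $|E'| > 0$. Let $G - E'$ denote the graph $(V, E \setminus E')$. Then $$\frac{|\mathrm{Aut}(G)|}{|\mathrm{AO}_G(E')|} = \frac{|\mathrm{Aut}(G - E')|}{|\mathrm{AO}_{G-E'}(E')|}.$$ Here, in $G$, $E'$ is a set of edges, while in $G - E'$ the same set $E'$ of vertex pairs is a set of non-edges.
   Context: Graphs are finite, undirected, without loops or multiple edges; an edge is an unordered pair $\{a,b\}$ of distinct vertices, also written $(a,b)$ with $(a,b) \equiv (b,a)$. For a bijection $f : V \to V$, write $f((a,b)) = (f(a), f(b))$, and for a set $X$ of vertex pairs write $f(X) = \{ f((a,b)) : (a,b) \in X\}$. An automorphism of a graph $H = (V, F)$ is a bijection $f : V \to V$ such that for all vertex pairs $(a,b)$, $(a,b) \in F$ if and only if $f((a,b)) \in F$; $\mathrm{Aut}(H)$ denotes the set (group) of all automorphisms of $H$. For a set $X$ of vertex pairs (which may consist of edges, non-edges, or both), its automorphism orbit in $H$ is $\mathrm{AO}_H(X) = \{ f(X) : f \in \mathrm{Aut}(H)\}$, a set of sets of vertex pairs; $|\mathrm{AO}_H(X)|$ is the number of distinct such sets. -}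

module Defs where

open import Data.Nat using (ℕ; zero; suc)
open import Data.Bool using (Bool; true; false; _∧_; not; T)
open import Data.Fin using (Fin)
open import Data.Fin.Properties using (_≟_; all?; any?)
open import Data.List using (List; []; _∷_; [_]; map; concatMap; filter; length; deduplicate; allFin)
open import Data.Vec using (Vec; lookup; tabulate) renaming ([] to []ᵥ; _∷_ to _∷ᵥ_)
import Data.Vec.Properties as VecP
import Data.Bool.Properties as BoolP
open import Relation.Binary.PropositionalEquality using (_≡_)
open import Relation.Nullary using (Dec; yes; no; ¬_)
open import Relation.Nullary.Decidable using (⌊_⌋; _→-dec_; _×-dec_)
open import Data.Product using (_×_)

-- The same record also represents a set of unordered vertex pairs
-- (a pair {a,b} with a ≠ b is in the set iff adj a b ≡ true).
record Graph (n : ℕ) : Set where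
  field
    adj    : Fin n → Fin n → Bool
    sym    : ∀ a b → adj a b ≡ adj b a
    irrefl : ∀ a → adj a a ≡ false
open Graph public

_⊆E_ : ∀ {n} → Graph n → Graph n → Set
X ⊆E G = ∀ a b → adj X a b ≡ true → adj G a b ≡ true

_－_ : ∀ {n} → Graph n → Graph n → Graph n
adj (G － X) a b = adj G a b ∧ not (adj X a b)
sym (G － X) a b rewrite sym G a b | sym X a b = Relation.Binary.PropositionalEquality.refl
irrefl (G － X) a rewrite irrefl G a = Relation.Binary.PropositionalEquality.refl

allVecs : ∀ {n} (k : ℕ) → List (Vec (Fin n) k)
allVecs zero = [ []ᵥ ]
allVecs {n} (suc k) = concatMap (λ x → map (x ∷ᵥ_) (allVecs k)) (allFin n)

allMaps : ∀ n → List (Vec (Fin n) n)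
allMaps n = allVecs n

-- A map Fin n → Fin n is a bijection (for an endomap of a finite set,
-- bijective ⇔ injective).
IsBijection : ∀ {n} → Vec (Fin n) n → Set
IsBijection {n} f = ∀ (i j : Fin n) → lookup f i ≡ lookup f j → i ≡ j

isBijection? : ∀ {n} (f : Vec (Fin n) n) → Dec (IsBijection f)
isBijection? f = all? λ i → all? λ j → (lookup f i ≟ lookup f j) →-dec (i ≟ j)

IsAut : ∀ {n} → Graph n → Vec (Fin n) n → Set
IsAut {n} H f = IsBijection f × (∀ (a b : Fin n) → adj H a b ≡ adj H (lookup f a) (lookup f b))

isAut? : ∀ {n} (H : Graph n) (f : Vec (Fin n) n) → Dec (IsAut H f)
isAut? H f = isBijection? f ×-dec
  (all? λ a → all? λ b → adj H a b BoolP.≟ adj H (lookup f a) (lookup f b))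

autList : ∀ {n} → Graph n → List (Vec (Fin n) n)
autList {n} H = filter (isAut? H) (allMaps n)

numAut : ∀ {n} → Graph n → ℕ
numAut H = length (autList H)

image : ∀ {n} → Vec (Fin n) n → Graph n → Vec (Vec Bool n) n
image f X = tabulate λ c → tabulate λ d →
  ⌊ any? (λ a → any? (λ b →
       (adj X a b BoolP.≟ true) ×-dec ((lookup f a ≟ c) ×-dec (lookup f b ≟ d)))) ⌋

numOrbit : ∀ {n} → Graph n → Graph n → ℕ
numOrbit {n} H X =
  length (deduplicate (VecP.≡-dec (VecP.≡-dec BoolP._≟_)) (map (λ f → image f X) (autList H)))

{-# OPTIONS --safe #-}
module Submission where

-- By the orbit–stabiliser theorem, |Aut H| = |AO_H(X)| · |Stab_H(X)|, where
-- Stab_H(X) consists of the automorphisms of H mapping X onto itself.  If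
-- X ⊆ E(G), the edge set of G is the disjoint union of those of G - X and X,
-- so a permutation fixing X setwise preserves G iff it preserves G - X:
-- Stab_G(X) = Stab_{G-X}(X), and cross-multiplying the two orbit–stabiliser
-- identities gives the theorem.

open import Defs hiding (sym)
open import Data.Bool using (Bool; true; false; _∧_; _∨_; not)
open import Data.Empty using (⊥-elim)
open import Data.Fin using (Fin)
open import Data.Fin.Properties using (_≟_; any?; injective⇒≤; punchOut-injective)
open import Data.List using (List; []; _∷_; map; concatMap; filter; length; deduplicate)
open import Data.List.Properties using (length-map; length-++)
open import Data.List.Membership.Propositional using (_∈_)
open import Data.List.Membership.Propositional.Properties
  using (∈-map⁺; ∈-map⁻; ∈-concatMap⁺; ∈-concatMap⁻; ∈-filter⁺; ∈-filter⁻; ∈-deduplicate⁺; ∈-deduplicate⁻; ∈-allFin)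
open import Data.List.Membership.Propositional.Properties.WithK using (unique∧set⇒bag)
open import Data.List.Relation.Binary.BagAndSetEquality using (_∼[_]_; set; ∼bag⇒↭)
open import Data.List.Relation.Binary.Permutation.Propositional.Properties using (↭-length)
open import Data.List.Relation.Unary.Any as Any using (here)
open import Data.List.Relation.Unary.All using ([])
open import Data.List.Relation.Unary.AllPairs using ([]; _∷_)
open import Data.List.Relation.Unary.Unique.Propositional using (Unique)
open import Data.List.Relation.Unary.Unique.Propositional.Properties
  using (Unique[x∷xs]⇒x∉xs; map⁺; ++⁺; filter⁺; allFin⁺)
open import Data.List.Relation.Unary.Unique.DecPropositional.Properties using (deduplicate-!)
open import Data.Nat using (ℕ; zero; suc; _+_; _*_)
open import Data.Nat.Properties using (1+n≰n; *-commutativeSemigroup)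
open import Algebra.Properties.CommutativeSemigroup *-commutativeSemigroup using (xy∙z≈zy∙x)
open import Data.Product using (Σ; ∃; _×_; _,_; proj₁; proj₂)
open import Data.Vec using (Vec; lookup; tabulate; head; allFin) renaming (map to mapᵥ; [] to []ᵥ; _∷_ to _∷ᵥ_)
open import Data.Vec.Properties using (∷-injectiveʳ; lookup-map; lookup∘tabulate; lookup-allFin; map-lookup-allFin)
import Data.Vec.Properties as VecP
import Data.Bool.Properties as BoolP
open import Data.Vec.Relation.Binary.Pointwise.Extensional using (ext; Pointwise-≡⇒≡)
open import Function.Bundles using (mk⇔)
open import Relation.Binary.Definitions using (DecidableEquality)
open import Relation.Binary.PropositionalEquality
  using (_≡_; refl; sym; trans; cong; cong₂; subst; subst₂; module ≡-Reasoning)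
open import Relation.Nullary using (Dec; yes; no; ¬_; contradiction)
open import Relation.Nullary.Decidable using (⌊_⌋)

∼set⇒length≡ : ∀ {A : Set} {xs ys : List A} → Unique xs → Unique ys → xs ∼[ set ] ys →
               length xs ≡ length ys
∼set⇒length≡ xs! ys! xs∼ys = ↭-length (∼bag⇒↭ (unique∧set⇒bag xs! ys! xs∼ys))

concatMap⁺ : ∀ {A B : Set} (F : A → List B) → (∀ a → Unique (F a)) →
             (∀ {b a a′} → b ∈ F a → b ∈ F a′ → a ≡ a′) →
             ∀ {as} → Unique as → Unique (concatMap F as)
concatMap⁺ F F! F-disjoint {[]} [] = []
concatMap⁺ F F! F-disjoint {a ∷ as} (a∉as ∷ as!) =
  ++⁺ (F! a) (concatMap⁺ F F! F-disjoint as!) λ (b∈Fa , b∈F[as]) →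
    Unique[x∷xs]⇒x∉xs (a∉as ∷ as!)
      (Any.map (λ b∈Fa′ → F-disjoint b∈Fa b∈Fa′) (∈-concatMap⁻ F b∈F[as]))

length-concatMap-const : ∀ {A B : Set} (F : A → List B) (c : ℕ) {as : List A} →
                         (∀ {a} → a ∈ as → length (F a) ≡ c) →
                         length (concatMap F as) ≡ length as * c
length-concatMap-const F c {[]} _ = refl
length-concatMap-const F c {a ∷ as} lengths = trans (length-++ (F a))
  (cong₂ _+_ (lengths (here refl)) (length-concatMap-const F c (λ a∈as → lengths (Any.there a∈as))))

module Fibres {A K : Set} (_≟ᴷ_ : DecidableEquality K) (key : A → K) (xs : List A) where

  fibre : K → List A
  fibre k = filter (λ x → key x ≟ᴷ k) xs

  keys : List K
  keys = deduplicate _≟ᴷ_ (map key xs)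

  fibre-unique : Unique xs → ∀ k → Unique (fibre k)
  fibre-unique xs! k = filter⁺ (λ x → key x ≟ᴷ k) xs!

  ∈-fibre⁺ : ∀ {x k} → x ∈ xs → key x ≡ k → x ∈ fibre k
  ∈-fibre⁺ {k = k} = ∈-filter⁺ (λ x → key x ≟ᴷ k)

  ∈-fibre⁻ : ∀ {x k} → x ∈ fibre k → x ∈ xs × key x ≡ k
  ∈-fibre⁻ {k = k} = ∈-filter⁻ (λ x → key x ≟ᴷ k)

  xs∼concatMap-fibre : xs ∼[ set ] concatMap fibre keys
  xs∼concatMap-fibre = mk⇔
    (λ x∈xs → ∈-concatMap⁺ fibre (Any.map (λ { refl → ∈-fibre⁺ x∈xs refl })
                (∈-deduplicate⁺ _≟ᴷ_ (∈-map⁺ key x∈xs))))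
    (λ x∈concat → let _ , x∈fibre = Any.satisfied (∈-concatMap⁻ fibre {xs = keys} x∈concat)
                  in proj₁ (∈-fibre⁻ x∈fibre))

  length≡length-keys* : Unique xs → ∀ c → (∀ {x} → x ∈ xs → length (fibre (key x)) ≡ c) →
                        length xs ≡ length keys * c
  length≡length-keys* xs! c fibre-length = trans
    (∼set⇒length≡ xs! fibres! xs∼concatMap-fibre)
    (length-concatMap-const fibre c λ k∈keys →
      let x , x∈xs , k≡key = ∈-map⁻ key (∈-deduplicate⁻ _≟ᴷ_ (map key xs) k∈keys)
      in subst (λ k → length (fibre k) ≡ c) (sym k≡key) (fibre-length x∈xs))
    where
    fibres! : Unique (concatMap fibre keys)
    fibres! = concatMap⁺ fibre (fibre-unique xs!)
      (λ x∈Fk x∈Fk′ → trans (sym (proj₂ (∈-fibre⁻ x∈Fk))) (proj₂ (∈-fibre⁻ x∈Fk′)))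
      (deduplicate-! _≟ᴷ_ (map key xs))

injective⇒surjective : ∀ {n} (f : Fin n → Fin n) → (∀ i j → f i ≡ f j → i ≡ j) →
                       ∀ c → ∃ λ i → f i ≡ c
injective⇒surjective {suc m} f f-inj c with any? (λ i → f i ≟ c)
... | yes found = found
-- A map missing c would give an injection punchOut c ∘ f : Fin (1 + m) → Fin m.
... | no c∉im = contradiction
      (injective⇒≤ λ {i} {j} eq → f-inj i j (punchOut-injective (c≢f i) (c≢f j) eq))
      (1+n≰n {m})
  where
  c≢f : ∀ i → ¬ c ≡ f i
  c≢f i c≡fi = c∉im (i , sym c≡fi)

lookup-ext : ∀ {A : Set} {n} {v w : Vec A n} → (∀ i → lookup v i ≡ lookup w i) → v ≡ w
lookup-ext v≗w = Pointwise-≡⇒≡ (ext v≗w)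

Endo : ℕ → Set
Endo n = Vec (Fin n) n

module _ {n : ℕ} where

  idᵥ : Endo n
  idᵥ = allFin n

  infixr 9 _∘ᵥ_
  _∘ᵥ_ : Endo n → Endo n → Endo n
  g ∘ᵥ f = mapᵥ (lookup g) f

  lookup-∘ᵥ : ∀ (g f : Endo n) i → lookup (g ∘ᵥ f) i ≡ lookup g (lookup f i)
  lookup-∘ᵥ g f i = lookup-map i (lookup g) f

  inverse : (f : Endo n) → IsBijection f → Endo n
  inverse f f-bij = tabulate λ c → proj₁ (injective⇒surjective (lookup f) f-bij c)

  module _ (f : Endo n) (f-bij : IsBijection f) where

    lookup-inverseʳ : ∀ c → lookup f (lookup (inverse f f-bij) c) ≡ c
    lookup-inverseʳ c = trans (cong (lookup f) (lookup∘tabulate _ c))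
                              (proj₂ (injective⇒surjective (lookup f) f-bij c))

    lookup-inverseˡ : ∀ a → lookup (inverse f f-bij) (lookup f a) ≡ a
    lookup-inverseˡ a = f-bij _ _ (lookup-inverseʳ (lookup f a))

    inverse-bijective : IsBijection (inverse f f-bij)
    inverse-bijective i j eq = trans (sym (lookup-inverseʳ i)) (trans (cong (lookup f) eq) (lookup-inverseʳ j))

    inverse-∘ᵥ : inverse f f-bij ∘ᵥ f ≡ idᵥ
    inverse-∘ᵥ = lookup-ext λ a → begin
      lookup (inverse f f-bij ∘ᵥ f) a       ≡⟨ lookup-∘ᵥ (inverse f f-bij) f a ⟩
      lookup (inverse f f-bij) (lookup f a) ≡⟨ lookup-inverseˡ a ⟩
      a                                     ≡⟨ sym (lookup-allFin a) ⟩
      lookup idᵥ a                          ∎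
      where open ≡-Reasoning

    ∘ᵥ-inverse-∘ᵥ : ∀ g → f ∘ᵥ (inverse f f-bij ∘ᵥ g) ≡ g
    ∘ᵥ-inverse-∘ᵥ g = lookup-ext λ a → begin
      lookup (f ∘ᵥ (inverse f f-bij ∘ᵥ g)) a               ≡⟨ lookup-∘ᵥ f (inverse f f-bij ∘ᵥ g) a ⟩
      lookup f (lookup (inverse f f-bij ∘ᵥ g) a)           ≡⟨ cong (lookup f) (lookup-∘ᵥ (inverse f f-bij) g a) ⟩
      lookup f (lookup (inverse f f-bij) (lookup g a))     ≡⟨ lookup-inverseʳ (lookup g a) ⟩
      lookup g a                                           ∎
      where open ≡-Reasoning

    ∘ᵥ-cancelˡ : ∀ {g h} → f ∘ᵥ g ≡ f ∘ᵥ h → g ≡ h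
    ∘ᵥ-cancelˡ {g} {h} eq = lookup-ext λ a →
      f-bij _ _ (trans (sym (lookup-∘ᵥ f g a)) (trans (cong (λ v → lookup v a) eq) (lookup-∘ᵥ f h a)))

  idᵥ-bijective : IsBijection idᵥ
  idᵥ-bijective i j eq = trans (sym (lookup-allFin i)) (trans eq (lookup-allFin j))

  ∘ᵥ-bijective : ∀ (g f : Endo n) → IsBijection g → IsBijection f → IsBijection (g ∘ᵥ f)
  ∘ᵥ-bijective g f g-bij f-bij i j eq =
    f-bij i j (g-bij _ _ (trans (sym (lookup-∘ᵥ g f i)) (trans eq (lookup-∘ᵥ g f j))))

Preserves : ∀ {n} → Graph n → Endo n → Set
Preserves {n} H f = ∀ (a b : Fin n) → adj H a b ≡ adj H (lookup f a) (lookup f b)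

module _ {n : ℕ} (H : Graph n) where

  ∘ᵥ-isAut : ∀ (g f : Endo n) → IsAut H g → IsAut H f → IsAut H (g ∘ᵥ f)
  ∘ᵥ-isAut g f (g-bij , g-pres) (f-bij , f-pres) = ∘ᵥ-bijective g f g-bij f-bij , λ a b →
    begin
      adj H a b                                             ≡⟨ f-pres a b ⟩
      adj H (lookup f a) (lookup f b)                       ≡⟨ g-pres _ _ ⟩
      adj H (lookup g (lookup f a)) (lookup g (lookup f b))
        ≡⟨ sym (cong₂ (adj H) (lookup-∘ᵥ g f a) (lookup-∘ᵥ g f b)) ⟩
      adj H (lookup (g ∘ᵥ f) a) (lookup (g ∘ᵥ f) b)         ∎
    where open ≡-Reasoning

  inverse-isAut : ∀ (g : Endo n) (g-aut : IsAut H g) → IsAut H (inverse g (proj₁ g-aut))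
  inverse-isAut g (g-bij , g-pres) = inverse-bijective g g-bij , λ a b →
    sym (trans (g-pres _ _) (cong₂ (adj H) (lookup-inverseʳ g g-bij a) (lookup-inverseʳ g g-bij b)))

∈-allVecs : ∀ {n} k (v : Vec (Fin n) k) → v ∈ allVecs k
∈-allVecs zero []ᵥ = here refl
∈-allVecs (suc k) (x ∷ᵥ v) =
  ∈-concatMap⁺ _ (Any.map (λ { refl → ∈-map⁺ (x ∷ᵥ_) (∈-allVecs k v) }) (∈-allFin x))

allVecs-unique : ∀ {n} k → Unique (allVecs {n} k)
allVecs-unique zero = [] ∷ []
allVecs-unique {n} (suc k) = concatMap⁺ (λ x → map (x ∷ᵥ_) (allVecs k))
  (λ x → map⁺ ∷-injectiveʳ (allVecs-unique k))
  (λ v∈x∷ v∈x′∷ → trans (sym (head-∈-map v∈x∷)) (head-∈-map v∈x′∷))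
  (allFin⁺ n)
  where
  head-∈-map : ∀ {x v} → v ∈ map (x ∷ᵥ_) (allVecs k) → head v ≡ x
  head-∈-map v∈ with ∈-map⁻ _ v∈
  ... | _ , _ , refl = refl

module _ {n : ℕ} (H : Graph n) where

  ∈-autList⁺ : ∀ f → IsAut H f → f ∈ autList H
  ∈-autList⁺ f = ∈-filter⁺ (isAut? H) (∈-allVecs n f)

  ∈-autList⁻ : ∀ {f} → f ∈ autList H → IsAut H f
  ∈-autList⁻ f∈ = proj₂ (∈-filter⁻ (isAut? H) {xs = allVecs n} f∈)

  autList-unique : Unique (autList H)
  autList-unique = filter⁺ (isAut? H) (allVecs-unique n)

entry : ∀ {A : Set} {n} → Vec (Vec A n) n → Fin n → Fin n → A
entry T c d = lookup (lookup T c) d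

table-ext-along : ∀ {A : Set} {n} {T U : Vec (Vec A n) n} (g : Endo n) → IsBijection g →
                  (∀ a b → entry T (lookup g a) (lookup g b) ≡ entry U (lookup g a) (lookup g b)) →
                  T ≡ U
table-ext-along {T = T} {U} g g-bij T≗U = lookup-ext λ c → lookup-ext λ d → at c d
  where
  at : ∀ c d → entry T c d ≡ entry U c d
  at c d with injective⇒surjective (lookup g) g-bij c | injective⇒surjective (lookup g) g-bij d
  ... | a , refl | b , refl = T≗U a b

module _ {n : ℕ} (X : Graph n) where

  entry-image : ∀ f → IsBijection f → ∀ a b →
                entry (image f X) (lookup f a) (lookup f b) ≡ adj X a b
  entry-image f f-bij a b =
    trans (cong (λ row → lookup row (lookup f b)) (lookup∘tabulate _ (lookup f a)))
          (trans (lookup∘tabulate _ (lookup f b)) (decide _))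
    where
    decide : (D : Dec (∃ λ a′ → ∃ λ b′ →
               adj X a′ b′ ≡ true × lookup f a′ ≡ lookup f a × lookup f b′ ≡ lookup f b)) →
             ⌊ D ⌋ ≡ adj X a b
    decide (yes (a′ , b′ , a′b′∈X , fa′≡fa , fb′≡fb)) =
      sym (subst₂ (λ x y → adj X x y ≡ true) (f-bij _ _ fa′≡fa) (f-bij _ _ fb′≡fb) a′b′∈X)
    decide (no ∄) with adj X a b in ab∈X
    ... | true  = ⊥-elim (∄ (a , b , ab∈X , refl , refl))
    ... | false = refl

  entry-image-idᵥ : ∀ c d → entry (image idᵥ X) c d ≡ adj X c d
  entry-image-idᵥ c d = subst₂ (λ c′ d′ → entry (image idᵥ X) c′ d′ ≡ adj X c d)
    (lookup-allFin c) (lookup-allFin d) (entry-image idᵥ idᵥ-bijective c d)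

  entry-image-∘ᵥ : ∀ g s → IsBijection g → IsBijection s → ∀ c d →
                   entry (image (g ∘ᵥ s) X) (lookup g c) (lookup g d) ≡ entry (image s X) c d
  entry-image-∘ᵥ g s g-bij s-bij c d
    with injective⇒surjective (lookup s) s-bij c | injective⇒surjective (lookup s) s-bij d
  ... | a , refl | b , refl = begin
    entry (image (g ∘ᵥ s) X) (lookup g (lookup s a)) (lookup g (lookup s b))
      ≡⟨ sym (cong₂ (entry (image (g ∘ᵥ s) X)) (lookup-∘ᵥ g s a) (lookup-∘ᵥ g s b)) ⟩
    entry (image (g ∘ᵥ s) X) (lookup (g ∘ᵥ s) a) (lookup (g ∘ᵥ s) b)
      ≡⟨ entry-image (g ∘ᵥ s) (∘ᵥ-bijective g s g-bij s-bij) a b ⟩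
    adj X a b
      ≡⟨ sym (entry-image s s-bij a b) ⟩
    entry (image s X) (lookup s a) (lookup s b) ∎
    where open ≡-Reasoning

  image-∘ᵥ-cong : ∀ g s t → IsBijection g → IsBijection s → IsBijection t →
                  image s X ≡ image t X → image (g ∘ᵥ s) X ≡ image (g ∘ᵥ t) X
  image-∘ᵥ-cong g s t g-bij s-bij t-bij s≈t = table-ext-along g g-bij λ c d → begin
    entry (image (g ∘ᵥ s) X) (lookup g c) (lookup g d) ≡⟨ entry-image-∘ᵥ g s g-bij s-bij c d ⟩
    entry (image s X) c d                              ≡⟨ cong (λ T → entry T c d) s≈t ⟩
    entry (image t X) c d                              ≡⟨ sym (entry-image-∘ᵥ g t g-bij t-bij c d) ⟩
    entry (image (g ∘ᵥ t) X) (lookup g c) (lookup g d) ∎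
    where open ≡-Reasoning

  image≡image-idᵥ⇒preserves : ∀ f → IsBijection f → image f X ≡ image idᵥ X → Preserves X f
  image≡image-idᵥ⇒preserves f f-bij f-fixes a b = begin
    adj X a b                                       ≡⟨ sym (entry-image f f-bij a b) ⟩
    entry (image f X) (lookup f a) (lookup f b)     ≡⟨ cong (λ T → entry T (lookup f a) (lookup f b)) f-fixes ⟩
    entry (image idᵥ X) (lookup f a) (lookup f b)   ≡⟨ entry-image-idᵥ _ _ ⟩
    adj X (lookup f a) (lookup f b)                 ∎
    where open ≡-Reasoning

_≟ᵀ_ : ∀ {n} → DecidableEquality (Vec (Vec Bool n) n)
_≟ᵀ_ = VecP.≡-dec (VecP.≡-dec BoolP._≟_)

module OrbitStabiliser {n : ℕ} (H X : Graph n) where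

  open Fibres _≟ᵀ_ (λ f → image f X) (autList H) public

  stabiliser : List (Endo n)
  stabiliser = fibre (image idᵥ X)

  fibre∼map-∘ᵥ-stabiliser : ∀ g → IsAut H g → fibre (image g X) ∼[ set ] map (g ∘ᵥ_) stabiliser
  fibre∼map-∘ᵥ-stabiliser g g-aut@(g-bij , _) = mk⇔ to from
    where
    g⁻¹ = inverse g g-bij

    to : ∀ {f} → f ∈ fibre (image g X) → f ∈ map (g ∘ᵥ_) stabiliser
    to {f} f∈fibre = subst (_∈ map (g ∘ᵥ_) stabiliser) (∘ᵥ-inverse-∘ᵥ g g-bij f)
      (∈-map⁺ (g ∘ᵥ_) (∈-fibre⁺ (∈-autList⁺ H (g⁻¹ ∘ᵥ f) g⁻¹f-aut) g⁻¹f-fixes))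
      where
      f-aut = ∈-autList⁻ H (proj₁ (∈-fibre⁻ f∈fibre))
      g⁻¹f-aut = ∘ᵥ-isAut H g⁻¹ f (inverse-isAut H g g-aut) f-aut
      g⁻¹f-fixes : image (g⁻¹ ∘ᵥ f) X ≡ image idᵥ X
      g⁻¹f-fixes = trans
        (image-∘ᵥ-cong X g⁻¹ f g (inverse-bijective g g-bij) (proj₁ f-aut) g-bij (proj₂ (∈-fibre⁻ f∈fibre)))
        (cong (λ h → image h X) (inverse-∘ᵥ g g-bij))

    from : ∀ {f} → f ∈ map (g ∘ᵥ_) stabiliser → f ∈ fibre (image g X)
    from f∈ with ∈-map⁻ (g ∘ᵥ_) f∈
    ... | s , s∈stabiliser , refl =
      ∈-fibre⁺ (∈-autList⁺ H (g ∘ᵥ s) (∘ᵥ-isAut H g s g-aut s-aut)) (trans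
        (image-∘ᵥ-cong X g s idᵥ g-bij (proj₁ s-aut) idᵥ-bijective (proj₂ (∈-fibre⁻ s∈stabiliser)))
        (cong (λ h → image h X) (map-lookup-allFin g)))
      where s-aut = ∈-autList⁻ H (proj₁ (∈-fibre⁻ s∈stabiliser))

  length-fibre : ∀ g → IsAut H g → length (fibre (image g X)) ≡ length stabiliser
  length-fibre g g-aut@(g-bij , _) = trans
    (∼set⇒length≡ (fibre-unique (autList-unique H) _)
                  (map⁺ (∘ᵥ-cancelˡ g g-bij) (fibre-unique (autList-unique H) _))
                  (fibre∼map-∘ᵥ-stabiliser g g-aut))
    (length-map (g ∘ᵥ_) stabiliser)

  orbit-stabiliser : numAut H ≡ numOrbit H X * length stabiliser
  orbit-stabiliser = length≡length-keys* (autList-unique H) (length stabiliser)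
    λ {g} g∈aut → length-fibre g (∈-autList⁻ H g∈aut)

open OrbitStabiliser using (stabiliser; orbit-stabiliser)

module _ {n : ℕ} (G X : Graph n) where

  preserves-－ : ∀ f → Preserves G f → Preserves X f → Preserves (G － X) f
  preserves-－ f G-pres X-pres a b = cong₂ (λ p q → p ∧ not q) (G-pres a b) (X-pres a b)

  adj-－-∨ : X ⊆E G → ∀ a b → adj G a b ≡ adj (G － X) a b ∨ adj X a b
  adj-－-∨ X⊆G a b with adj G a b in ab∈G | adj X a b in ab∈X
  ... | true  | true  = refl
  ... | true  | false = refl
  ... | false | false = refl
  ... | false | true  = trans (sym ab∈G) (X⊆G a b ab∈X)

  preserves-∪ : X ⊆E G → ∀ f → Preserves (G － X) f → Preserves X f → Preserves G f
  preserves-∪ X⊆G f G-X-pres X-pres a b = begin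
    adj G a b                                                                 ≡⟨ adj-－-∨ X⊆G a b ⟩
    adj (G － X) a b ∨ adj X a b                                              ≡⟨ cong₂ _∨_ (G-X-pres a b) (X-pres a b) ⟩
    adj (G － X) (lookup f a) (lookup f b) ∨ adj X (lookup f a) (lookup f b)  ≡⟨ sym (adj-－-∨ X⊆G _ _) ⟩
    adj G (lookup f a) (lookup f b)                                           ∎
    where open ≡-Reasoning

  length-stabiliser-－ : X ⊆E G → length (stabiliser G X) ≡ length (stabiliser (G － X) X)
  length-stabiliser-－ X⊆G = ∼set⇒length≡
    (OrbitStabiliser.fibre-unique G X (autList-unique G) _)
    (OrbitStabiliser.fibre-unique (G － X) X (autList-unique (G － X)) _)
    (mk⇔ (transfer G (G － X) preserves-－) (transfer (G － X) G (preserves-∪ X⊆G)))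
    where
    transfer : ∀ H H′ → (∀ f → Preserves H f → Preserves X f → Preserves H′ f) →
               ∀ {f} → f ∈ stabiliser H X → f ∈ stabiliser H′ X
    transfer H H′ H⇒H′ {f} f∈ =
      let f∈aut , f-fixes = OrbitStabiliser.∈-fibre⁻ H X f∈
          f-bij , H-pres = ∈-autList⁻ H f∈aut
          X-pres = image≡image-idᵥ⇒preserves X f f-bij f-fixes
      in OrbitStabiliser.∈-fibre⁺ H′ X (∈-autList⁺ H′ f (f-bij , H⇒H′ f H-pres X-pres)) f-fixes

mainTheorem1 : ∀ (n : ℕ) (G E' : Graph n) → E' ⊆E G
    → Σ (Fin n) (λ a → Σ (Fin n) (λ b → adj E' a b ≡ true))
    → numAut G * numOrbit (G － E') E' ≡ numAut (G － E') * numOrbit G E'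
mainTheorem1 n G E' E'⊆G _ = begin
  numAut G * numOrbit (G － E') E'
    ≡⟨ cong (_* numOrbit (G － E') E') (orbit-stabiliser G E') ⟩
  numOrbit G E' * length (stabiliser G E') * numOrbit (G － E') E'
    ≡⟨ cong (λ s → numOrbit G E' * s * numOrbit (G － E') E') (length-stabiliser-－ G E' E'⊆G) ⟩
  numOrbit G E' * length (stabiliser (G － E') E') * numOrbit (G － E') E'
    ≡⟨ xy∙z≈zy∙x (numOrbit G E') _ _ ⟩
  numOrbit (G － E') E' * length (stabiliser (G － E') E') * numOrbit G E'
    ≡⟨ cong (_* numOrbit G E') (sym (orbit-stabiliser (G － E') E')) ⟩
  numAut (G － E') * numOrbit G E' ∎
  where open ≡-Reasoning
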